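{- Let $\mathcal{F}$ be a closure system on a finite set $X$ with closure operator $\phi$ and canonical direct basis $\Sigma$, let $A\in\mathcal{F}$, $A\neq X$, be meet-irreducible in $\mathcal{F}$ with unique upper cover $A^*$, write $A^*\setminus A=\{d_1,\dots,d_k\}$, and let $Y_1,\dots,Y_t$ be the minimal transversals of the hypergraph $H=\langle A,\mathcal{T}\rangle$. Let $\Sigma_1=\{Y_j\rightarrow d_i: j\le t, i\le k\}$. Then $\Sigma\cup\Sigma_1$ is a direct basis of the closure system $\mathcal{F}^*=\mathcal{F}\setminus\{A\}$.
   Context: A closure system on $X$ is a family of subsets of $X$ containing $X$ and closed under intersections; its closure operator sends $Y$ to the least member containing $Y$. $A\in\mathcal{F}$ is meet-irreducible if $A=B\cap C$ with $B,C\in\mathcal{F}$ implies $B=A$ or $C=A$; for $A\neq X$ it has a unique upper cover $A^*$ in $(\mathcal{F},\subseteq)$. An implication $C\rightarrow d$ ($C\subseteq X,d\in X$) holds on $Z$ if $C\not\subseteq Z$ or $d\in Z$. A set of implications is a basis of a closure system if the sets on which all its implications hold are exactly the members of the system; it is direct for closure operator $\psi$ if $\psi(Y)=Y\cup\{d:(C\rightarrow d)\text{ in the set}, C\subseteq Y\}$ for all $Y$. The canonical direct basis of $\mathcal{F}$ is the set of all $C\rightarrow d$ with $d\in\phi(C)\setminus C$ and $d\notin\phi(C')$ for all $C'\subsetneq C$. A transversal of a hypergraph $\langle B,\mathcal{B}\rangle$ is $U\subseteq B$ meeting every member of $\mathcal{B}$; minimal transversals are the inclusion-minimal ones. Here $\mathcal{T}=\{A\setminus\phi(A'):A'\subseteq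 A,\ \phi(A')\neq A\}$. -}

module Defs where

open import Data.Nat using (ℕ)
open import Data.Fin using (Fin)
open import Data.Fin.Subset
  using (Subset; _∈_; _∉_; _⊆_; _⊈_; _⊂_; _∩_; _─_; ⊤; Nonempty)
open import Data.Fin.Subset.Properties using (_⊆?_)
open import Data.List using (List; foldr; filter)
open import Data.List.Membership.Propositional using () renaming (_∈_ to _∈ᶠ_)
open import Data.Vec.Properties using (≡-dec)
import Data.Bool as Bool
open import Data.Product using (_×_; ∃; ∃-syntax; _,_)
open import Data.Sum using (_⊎_)
open import Relation.Nullary using (¬_; Dec; ¬?)
open import Relation.Binary.PropositionalEquality using (_≡_; _≢_)

_≟ₛ_ : {n : ℕ} (p q : Subset n) → Dec (p ≡ q)
_≟ₛ_ = ≡-dec Bool._≟_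

Family : ℕ → Set
Family n = List (Subset n)

IsClosureSystem : {n : ℕ} → Family n → Set
IsClosureSystem F = (⊤ ∈ᶠ F) × (∀ B C → B ∈ᶠ F → C ∈ᶠ F → (B ∩ C) ∈ᶠ F)

closure : {n : ℕ} → Family n → Subset n → Subset n
closure F Y = foldr _∩_ ⊤ (filter (λ W → Y ⊆? W) F)

MeetIrreducible : {n : ℕ} → Family n → Subset n → Set
MeetIrreducible F A =
  A ∈ᶠ F × (∀ B C → B ∈ᶠ F → C ∈ᶠ F → A ≡ B ∩ C → (B ≡ A ⊎ C ≡ A))

IsUpperCover : {n : ℕ} → Family n → Subset n → Subset n → Set
IsUpperCover F A A* =
  A* ∈ᶠ F × A ⊂ A* × (∀ W → W ∈ᶠ F → A ⊂ W → W ⊂ A* → Data.Empty.⊥)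
  where import Data.Empty

removeMember : {n : ℕ} → Family n → Subset n → Family n
removeMember F A = filter (λ W → ¬? (W ≟ₛ A)) F

record Implication (n : ℕ) : Set where
  constructor _⇒_
  field
    premise    : Subset n
    conclusion : Fin n

ImpSet : ℕ → Set₁
ImpSet n = Implication n → Set

_∪ᵢ_ : {n : ℕ} → ImpSet n → ImpSet n → ImpSet n
(S ∪ᵢ T) i = S i ⊎ T i

HoldsOn : {n : ℕ} → Implication n → Subset n → Set
HoldsOn (C ⇒ d) Z = C ⊈ Z ⊎ d ∈ Z

IsBasis : {n : ℕ} → ImpSet n → Family n → Set
IsBasis S F =
  ∀ Z → (Z ∈ᶠ F → ∀ i → S i → HoldsOn i Z)
      × ((∀ i → S i → HoldsOn i Z) → Z ∈ᶠ F)

IsDirectFor : {n : ℕ} → ImpSet n → (Subset n → Subset n) → Set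
IsDirectFor S ψ =
  ∀ Y d → (d ∈ ψ Y → (d ∈ Y ⊎ ∃[ C ] (S (C ⇒ d) × C ⊆ Y)))
        × ((d ∈ Y ⊎ ∃[ C ] (S (C ⇒ d) × C ⊆ Y)) → d ∈ ψ Y)

IsDirectBasis : {n : ℕ} → ImpSet n → Family n → Set
IsDirectBasis S F = IsBasis S F × IsDirectFor S (closure F)

CanonicalDirectBasis : {n : ℕ} → Family n → ImpSet n
CanonicalDirectBasis F (C ⇒ d) =
  d ∈ closure F C × d ∉ C × (∀ C' → C' ⊂ C → d ∉ closure F C')

TEdge : {n : ℕ} → Family n → Subset n → Subset n → Set
TEdge F A T = ∃[ A' ] (A' ⊆ A × closure F A' ≢ A × T ≡ A ─ closure F A')

IsTransversal : {n : ℕ} → Subset n → (Subset n → Set) → Subset n → Set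
IsTransversal B ℬ U = U ⊆ B × (∀ T → ℬ T → Nonempty (U ∩ T))

IsMinimalTransversal : {n : ℕ} → Subset n → (Subset n → Set) → Subset n → Set
IsMinimalTransversal B ℬ U =
  IsTransversal B ℬ U × (∀ V → V ⊂ U → ¬ IsTransversal B ℬ V)

Sigma1 : {n : ℕ} → Family n → Subset n → Subset n → ImpSet n
Sigma1 F A A* (Y ⇒ d) =
  IsMinimalTransversal A (TEdge F A) Y × d ∈ A* × d ∉ A

-- A subset V ⊆ A is a transversal of ⟨A, 𝒯⟩ exactly when φ(V) = A: if φ(V) ≠ A then
-- A ∖ φ(V) is an edge missed by V, and conversely V meets every A ∖ φ(A') with
-- φ(A') ≠ A, since V ⊆ φ(A') would force A = φ(V) ⊆ φ(A').  Removing the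
-- meet-irreducible A from 𝓕 only changes the closure of the sets Y with φ(Y) = A,
-- which now close to A*, the least member of 𝓕 strictly above A.  The new elements
-- A* ∖ A are thus forced by exactly the sets generating A, i.e. by the supersets of a
-- minimal transversal; this is what Σ₁ adds to the canonical direct basis Σ.
module Submission where

open import Defs
open import Data.Nat using (ℕ)
open import Data.Fin using (Fin; zero)
open import Data.Fin.Properties using (¬∀⟶∃¬)
open import Data.Fin.Subset
  using (Subset; ⊤; _∈_; _∉_; _⊆_; _⊈_; _⊂_; _∩_; _─_; ⋂; Nonempty; inside; outside)
open import Data.Fin.Subset.Properties
  using (_⊆?_; _⊂?_; _∈?_; anySubset?; x∈p∩q⁺; x∈p∩q⁻; ⊆-refl; ⊆-trans; ⊆-antisym;
         ⊂-irref; p⊂q⇒p⊆q; p∩q⊆p; p∩q⊆q; x∈p∧x∉q⇒x∈p─q; drop-there; ∈⊤)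
open import Data.Fin.Subset.Induction using (⊂-wellFounded)
open import Data.Vec using (_∷_)
import Data.Vec as Vec using (here; there)
open import Data.List using (List; []; _∷_; filter)
open import Data.List.Membership.Propositional using () renaming (_∈_ to _∈ᶠ_)
open import Data.List.Membership.Propositional.Properties using (∈-filter⁺; ∈-filter⁻)
open import Data.List.Relation.Unary.Any using (here; there)
open import Data.Product using (_×_; ∃-syntax; _,_; proj₁; proj₂)
open import Data.Empty using (⊥-elim)
open import Data.Sum using (_⊎_; inj₁; inj₂)
open import Function using (_∘_)
open import Induction.WellFounded using (Acc; acc)
open import Relation.Nullary using (¬_; Dec; yes; no; ¬?; contradiction)
open import Relation.Nullary.Decidable using (_×-dec_; _→-dec_)
open import Relation.Binary.PropositionalEquality using (_≡_; _≢_; refl; sym; subst)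

private
  variable
    n : ℕ
    F : Family n

x∈p─q⇒x∉q : ∀ {p q : Subset n} {x : Fin n} → x ∈ p ─ q → x ∉ q
x∈p─q⇒x∉q {p = inside ∷ _}  {outside ∷ _} Vec.here = λ ()
x∈p─q⇒x∉q {p = _ ∷ _}       {inside ∷ _}  {zero} ()
x∈p─q⇒x∉q {p = outside ∷ _} {outside ∷ _} {zero} ()
x∈p─q⇒x∉q {p = _ ∷ _}       {_ ∷ _}       (Vec.there x∈p─q) =
  x∈p─q⇒x∉q x∈p─q ∘ drop-there

p⊈q⇒∃ : ∀ {p q : Subset n} → p ⊈ q → ∃[ x ] (x ∈ p × x ∉ q)
p⊈q⇒∃ {n} {p} {q} p⊈q with ¬∀⟶∃¬ n (λ x → x ∈ p → x ∈ q) (λ x → (x ∈? p) →-dec (x ∈? q))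
                           (λ p⊆q → p⊈q (p⊆q _))
... | x , ¬x∈p⇒x∈q with x ∈? p
...   | yes x∈p = x , x∈p , ¬x∈p⇒x∈q ∘ λ x∈q _ → x∈q
...   | no  x∉p = contradiction (λ x∈p → contradiction x∈p x∉p) ¬x∈p⇒x∈q

p⊆q∧p≢q⇒p⊂q : ∀ {p q : Subset n} → p ⊆ q → p ≢ q → p ⊂ q
p⊆q∧p≢q⇒p⊂q {p = p} {q} p⊆q p≢q with q ⊆? p
... | yes q⊆p = contradiction (⊆-antisym p⊆q q⊆p) p≢q
... | no  q⊈p = p⊆q , p⊈q⇒∃ q⊈p

∃-minimal⊆ : (P : Subset n → Set) → (∀ V → Dec (P V)) → ∀ Y → P Y →
             ∃[ V ] (V ⊆ Y × P V × (∀ V' → V' ⊂ V → ¬ P V'))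
∃-minimal⊆ P P? Y = go Y (⊂-wellFounded Y)
  where
  go : ∀ Y → Acc _⊂_ Y → P Y → ∃[ V ] (V ⊆ Y × P V × (∀ V' → V' ⊂ V → ¬ P V'))
  go Y (acc rec) pY with anySubset? (λ V → (V ⊂? Y) ×-dec P? V)
  ... | no  ∄smaller = Y , ⊆-refl , pY , λ V V⊂Y pV → ∄smaller (V , V⊂Y , pV)
  ... | yes (V , V⊂Y , pV) with go V (rec V⊂Y) pV
  ...   | W , W⊆V , pW , minimal = W , ⊆-trans W⊆V (p⊂q⇒p⊆q V⊂Y) , pW , minimal

x∈⋂⁻ : ∀ (L : List (Subset n)) {x} → x ∈ ⋂ L → ∀ {W} → W ∈ᶠ L → x ∈ W
x∈⋂⁻ (U ∷ L) x∈⋂ (here refl) = proj₁ (x∈p∩q⁻ U _ x∈⋂)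
x∈⋂⁻ (U ∷ L) x∈⋂ (there W∈L) = x∈⋂⁻ L (proj₂ (x∈p∩q⁻ U _ x∈⋂)) W∈L

x∈⋂⁺ : ∀ (L : List (Subset n)) {x} → (∀ {W} → W ∈ᶠ L → x ∈ W) → x ∈ ⋂ L
x∈⋂⁺ []      _      = ∈⊤
x∈⋂⁺ (U ∷ L) x∈all = x∈p∩q⁺ (x∈all (here refl) , x∈⋂⁺ L (x∈all ∘ there))

⋂-∈ : IsClosureSystem F → ∀ (L : List (Subset n)) → (∀ {W} → W ∈ᶠ L → W ∈ᶠ F) → ⋂ L ∈ᶠ F
⋂-∈ (⊤∈F , _)     []      _     = ⊤∈F
⋂-∈ cs@(_ , ∩∈F) (U ∷ L) L⊆F = ∩∈F U _ (L⊆F (here refl)) (⋂-∈ cs L (L⊆F ∘ there))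

module _ (F : Family n) {Y : Subset n} where

  private
    above : List (Subset n)
    above = filter (Y ⊆?_) F

  x∈closure⁺ : ∀ {x} → (∀ W → W ∈ᶠ F → Y ⊆ W → x ∈ W) → x ∈ closure F Y
  x∈closure⁺ x∈all = x∈⋂⁺ above λ W∈ → let (W∈F , Y⊆W) = ∈-filter⁻ (Y ⊆?_) {xs = F} W∈
                                        in x∈all _ W∈F Y⊆W

  closure-extensive : Y ⊆ closure F Y
  closure-extensive y∈Y = x∈closure⁺ λ _ _ Y⊆W → Y⊆W y∈Y

  closure-least : ∀ {W} → W ∈ᶠ F → Y ⊆ W → closure F Y ⊆ W
  closure-least W∈F Y⊆W x∈ = x∈⋂⁻ above x∈ (∈-filter⁺ (Y ⊆?_) W∈F Y⊆W)

  closure-∈ : IsClosureSystem F → closure F Y ∈ᶠ F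
  closure-∈ cs = ⋂-∈ cs above (proj₁ ∘ ∈-filter⁻ (Y ⊆?_) {xs = F})

closure-fixed : ∀ {W} → W ∈ᶠ F → closure F W ≡ W
closure-fixed {F = F} W∈F = ⊆-antisym (closure-least F W∈F ⊆-refl) (closure-extensive F)

∈-removeMember⁺ : ∀ {A W : Subset n} → W ∈ᶠ F → W ≢ A → W ∈ᶠ removeMember F A
∈-removeMember⁺ {A = A} = ∈-filter⁺ (λ W → ¬? (W ≟ₛ A))

∈-removeMember⁻ : ∀ {A W : Subset n} → W ∈ᶠ removeMember F A → W ∈ᶠ F × W ≢ A
∈-removeMember⁻ {F = F} {A} = ∈-filter⁻ (λ W → ¬? (W ≟ₛ A)) {xs = F}

holdsOn⁺ : ∀ {C : Subset n} {d Z} → (C ⊆ Z → d ∈ Z) → HoldsOn (C ⇒ d) Z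
holdsOn⁺ {C = C} {Z = Z} C⊆Z⇒d∈Z with C ⊆? Z
... | yes C⊆Z = inj₂ (C⊆Z⇒d∈Z C⊆Z)
... | no  C⊈Z = inj₁ C⊈Z

canonical-sound : ∀ {C d W} → CanonicalDirectBasis F (C ⇒ d) → W ∈ᶠ F → C ⊆ W → d ∈ W
canonical-sound {F = F} (d∈φC , _) W∈F C⊆W = closure-least F W∈F C⊆W d∈φC

∃-canonicalPremise : (F : Family n) {Y : Subset n} {d : Fin n} → d ∈ closure F Y → d ∉ Y →
                     ∃[ C ] (CanonicalDirectBasis F (C ⇒ d) × C ⊆ Y)
∃-canonicalPremise F {Y} {d} d∈φY d∉Y
  with ∃-minimal⊆ (λ C → d ∈ closure F C) (λ C → d ∈? closure F C) Y d∈φY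
... | C , C⊆Y , d∈φC , minimal = C , (d∈φC , d∉Y ∘ C⊆Y , minimal) , C⊆Y

canonical-holds⇒∈ : IsClosureSystem F → ∀ {Z} →
                    (∀ i → CanonicalDirectBasis F i → HoldsOn i Z) → Z ∈ᶠ F
canonical-holds⇒∈ {F = F} cs {Z} holds =
  subst (_∈ᶠ F) (⊆-antisym φZ⊆Z (closure-extensive F)) (closure-∈ F cs)
  where
  φZ⊆Z : closure F Z ⊆ Z
  φZ⊆Z {d} d∈φZ with d ∈? Z
  ... | yes d∈Z = d∈Z
  ... | no  d∉Z with ∃-canonicalPremise F d∈φZ d∉Z
  ...   | C , C→d , C⊆Z with holds (C ⇒ d) C→d
  ...     | inj₁ C⊈Z = ⊥-elim (C⊈Z C⊆Z)
  ...     | inj₂ d∈Z = d∈Z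

Generates : Family n → Subset n → Subset n → Set
Generates F A V = V ⊆ A × closure F V ≡ A

module _ {F : Family n} {A : Subset n} where

  transversal⇒generates : ∀ {V} → IsTransversal A (TEdge F A) V → Generates F A V
  transversal⇒generates {V} (V⊆A , meets) with closure F V ≟ₛ A
  ... | yes φV≡A = V⊆A , φV≡A
  ... | no  φV≢A with meets (A ─ closure F V) (V , V⊆A , φV≢A , refl)
  ...   | x , x∈V∩T = contradiction (closure-extensive F (proj₁ (x∈p∩q⁻ V _ x∈V∩T)))
                                    (x∈p─q⇒x∉q (proj₂ (x∈p∩q⁻ V _ x∈V∩T)))

  generates⇒transversal : IsClosureSystem F → A ∈ᶠ F →
                          ∀ {V} → Generates F A V → IsTransversal A (TEdge F A) V
  generates⇒transversal cs A∈F {V} (V⊆A , φV≡A) = V⊆A , meets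
    where
    meets : ∀ T → TEdge F A T → Nonempty (V ∩ T)
    meets _ (A' , A'⊆A , φA'≢A , refl) with V ⊆? closure F A'
    ... | yes V⊆φA' = contradiction A≡φA' (φA'≢A ∘ sym)
      where
      A≡φA' : A ≡ closure F A'
      A≡φA' = ⊆-antisym
        (subst (_⊆ closure F A') φV≡A (closure-least F (closure-∈ F cs) V⊆φA'))
        (closure-least F A∈F A'⊆A)
    ... | no  V⊈φA' with p⊈q⇒∃ V⊈φA'
    ...   | x , x∈V , x∉φA' = x , x∈p∩q⁺ (x∈V , x∈p∧x∉q⇒x∈p─q (V⊆A x∈V) x∉φA')

  ∃-minimalTransversal⊆ : IsClosureSystem F → A ∈ᶠ F → ∀ {Y} → Generates F A Y →
                          ∃[ V ] (V ⊆ Y × IsMinimalTransversal A (TEdge F A) V)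
  ∃-minimalTransversal⊆ cs A∈F {Y} genY
    with ∃-minimal⊆ (Generates F A) (λ V → (V ⊆? A) ×-dec (closure F V ≟ₛ A)) Y genY
  ... | V , V⊆Y , genV , minimal =
    V , V⊆Y , generates⇒transversal cs A∈F genV ,
    λ V' V'⊂V → minimal V' V'⊂V ∘ transversal⇒generates

module _ {F : Family n} (cs : IsClosureSystem F) {A A* : Subset n}
         (meetIrr : MeetIrreducible F A) (cover : IsUpperCover F A A*) where

  private
    A∈F : A ∈ᶠ F
    A∈F = proj₁ meetIrr

    A*∈F : A* ∈ᶠ F
    A*∈F = proj₁ cover

    A⊂A* : A ⊂ A*
    A⊂A* = proj₁ (proj₂ cover)

    A*≢A : A* ≢ A
    A*≢A A*≡A = ⊂-irref (sym A*≡A) A⊂A*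

    F* : Family n
    F* = removeMember F A

    Σ∪Σ₁ : ImpSet n
    Σ∪Σ₁ = CanonicalDirectBasis F ∪ᵢ Sigma1 F A A*

  -- W ∩ A* lies between A and A*, and meet-irreducibility rules out W ∩ A* = A.
  upperCover⊆ : ∀ {W} → W ∈ᶠ F → A ⊆ W → W ≢ A → A* ⊆ W
  upperCover⊆ {W} W∈F A⊆W W≢A with (W ∩ A*) ≟ₛ A* | (W ∩ A*) ≟ₛ A
  ... | yes W∩A*≡A* | _ = p∩q⊆p W A* ∘ subst (_ ∈_) (sym W∩A*≡A*)
  ... | no  _       | yes W∩A*≡A with proj₂ meetIrr W A* W∈F A*∈F (sym W∩A*≡A)
  ...   | inj₁ W≡A  = contradiction W≡A W≢A
  ...   | inj₂ A*≡A = contradiction A*≡A A*≢A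
  upperCover⊆ {W} W∈F A⊆W W≢A | no W∩A*≢A* | no W∩A*≢A =
    contradiction (p⊆q∧p≢q⇒p⊂q (p∩q⊆q W A*) W∩A*≢A*)
      (proj₂ (proj₂ cover) (W ∩ A*) (proj₂ cs W A* W∈F A*∈F)
        (p⊆q∧p≢q⇒p⊂q (λ x∈A → x∈p∩q⁺ (A⊆W x∈A , proj₁ A⊂A* x∈A)) (W∩A*≢A ∘ sym)))

  Σ∪Σ₁-sound : ∀ {C d W} → Σ∪Σ₁ (C ⇒ d) → W ∈ᶠ F* → C ⊆ W → d ∈ W
  Σ∪Σ₁-sound (inj₁ C→d) W∈F* = canonical-sound C→d (proj₁ (∈-removeMember⁻ {F = F} W∈F*))
  Σ∪Σ₁-sound {W = W} (inj₂ ((transversal , _) , d∈A* , _)) W∈F* C⊆W =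
    upperCover⊆ W∈F A⊆W W≢A d∈A*
    where
    W∈F : W ∈ᶠ F
    W∈F = proj₁ (∈-removeMember⁻ {F = F} W∈F*)
    W≢A : W ≢ A
    W≢A = proj₂ (∈-removeMember⁻ {F = F} W∈F*)
    A⊆W : A ⊆ W
    A⊆W = subst (_⊆ W) (proj₂ (transversal⇒generates {F = F} transversal))
                (closure-least F W∈F C⊆W)

  Σ₁-holds⇒≢A : ∀ {Z} → (∀ i → Σ∪Σ₁ i → HoldsOn i Z) → Z ≢ A
  Σ₁-holds⇒≢A holds refl with ∃-minimalTransversal⊆ cs A∈F (⊆-refl , closure-fixed A∈F)
                            | proj₂ A⊂A*
  ... | V , V⊆A , minimal | d , d∈A* , d∉A with holds (V ⇒ d) (inj₂ (minimal , d∈A* , d∉A))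
  ...   | inj₁ V⊈A = V⊈A V⊆A
  ...   | inj₂ d∈A = d∉A d∈A

  basis : IsBasis Σ∪Σ₁ F*
  basis Z = (λ Z∈F* _ C→d → holdsOn⁺ (Σ∪Σ₁-sound C→d Z∈F*))
          , (λ holds → ∈-removeMember⁺ (canonical-holds⇒∈ cs (λ i → holds i ∘ inj₁))
                                       (Σ₁-holds⇒≢A holds))

  direct-complete : ∀ Y d → d ∈ closure F* Y → d ∈ Y ⊎ ∃[ C ] (Σ∪Σ₁ (C ⇒ d) × C ⊆ Y)
  direct-complete Y d d∈φ*Y with d ∈? Y | d ∈? closure F Y | closure F Y ≟ₛ A
  ... | yes d∈Y | _ | _ = inj₁ d∈Y
  ... | no d∉Y | yes d∈φY | _ with ∃-canonicalPremise F d∈φY d∉Y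
  ...   | C , C→d , C⊆Y = inj₂ (C , inj₁ C→d , C⊆Y)
  direct-complete Y d d∈φ*Y | no _ | no d∉φY | no φY≢A =
    contradiction (closure-least F* (∈-removeMember⁺ (closure-∈ F cs) φY≢A)
                                    (closure-extensive F) d∈φ*Y)
                  d∉φY
  direct-complete Y d d∈φ*Y | no _ | no d∉φY | yes φY≡A
    with ∃-minimalTransversal⊆ cs A∈F (subst (Y ⊆_) φY≡A (closure-extensive F) , φY≡A)
  ... | V , V⊆Y , minimal = inj₂ (V , inj₂ (minimal , d∈A* , d∉A) , V⊆Y)
    where
    d∉A : d ∉ A
    d∉A = d∉φY ∘ subst (d ∈_) (sym φY≡A)
    d∈A* : d ∈ A*
    d∈A* = closure-least F* (∈-removeMember⁺ A*∈F A*≢A)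
             (proj₁ A⊂A* ∘ subst (Y ⊆_) φY≡A (closure-extensive F)) d∈φ*Y

  direct-sound : ∀ Y d → d ∈ Y ⊎ ∃[ C ] (Σ∪Σ₁ (C ⇒ d) × C ⊆ Y) → d ∈ closure F* Y
  direct-sound Y d (inj₁ d∈Y)             = closure-extensive F* d∈Y
  direct-sound Y d (inj₂ (C , C→d , C⊆Y)) =
    x∈closure⁺ F* λ _ W∈F* Y⊆W → Σ∪Σ₁-sound C→d W∈F* (Y⊆W ∘ C⊆Y)

  directBasis : IsDirectBasis Σ∪Σ₁ F*
  directBasis = basis , λ Y d → direct-complete Y d , direct-sound Y d

mainTheorem10 : (n : ℕ) (F : Family n) → IsClosureSystem F
                → (A A* : Subset n) → MeetIrreducible F A → A ≢ ⊤
                → IsUpperCover F A A*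
                → IsDirectBasis (CanonicalDirectBasis F ∪ᵢ Sigma1 F A A*) (removeMember F A)
mainTheorem10 n F cs A A* meetIrr _ cover = directBasis cs meetIrr cover
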